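{- Let $t>1$ be an odd natural number, $n=2t+1$, and let $k$ be a natural number with $\gcd(k,n)=1$. Then the odd Niho exponent $2^t+2^{(3t+1)/2}-1$ never lies in the cyclotomic coset of $e(l,k)$ modulo $2^n-1$, for any natural number $l$.
   Context: For natural numbers $l,k$, $e(l,k)=\sum_{j=0}^{l-1}2^{jk}$. The cyclotomic coset of $d$ modulo $2^n-1$ is $\{2^a d \bmod (2^n-1): a\ge 0\}$. -}

module Defs where

open import Data.Nat using (ℕ; zero; suc; _+_; _*_; _∸_; _^_)
open import Data.Nat.DivMod using (_%_; _/_)
open import Data.Nat.Base using (NonZero)
open import Data.Product using (∃-syntax)
open import Relation.Binary.PropositionalEquality using (_≡_)

e : ℕ → ℕ → ℕ
e zero    k = 0
e (suc l) k = e l k + 2 ^ (l * k)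

InCyclotomicCoset : (n d x : ℕ) → .{{NonZero (2 ^ n ∸ 1)}} → Set
InCyclotomicCoset n d x = ∃[ a ] ((2 ^ a * x) % (2 ^ n ∸ 1) ≡ d % (2 ^ n ∸ 1))

nihoOdd : ℕ → ℕ
nihoOdd t = 2 ^ t + 2 ^ ((3 * t + 1) / 2) ∸ 1

-- Let M = 2^n - 1 and L = l mod n.  Modulo M we have 2^a e(l,k) = 2^a e(L,k) = Σ_{i<L} 2^((a + i k) mod n),
-- and as k is a unit mod n these exponents are distinct, so the right-hand side is the binary expansion of a
-- residue below M.  The Niho exponent 2^t + 2^s - 1, s = (3t+1)/2, has binary support [0,t) ∪ {s}; so if it
-- lay in the coset, [0,t) ∪ {s} would be an arithmetic progression {(a + i k) mod n : i < L}.  For c = k mod n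
-- such a progression has at most one element x with x + c < n and x + c outside it (its last term), and
-- likewise for the step n - c (its first term).  One of c, n - c is at most t, but for every step 1 ≤ d ≤ t
-- the set [0,t) ∪ {s} has two such elements: t - 1 and s for d = 1, and otherwise two of t - 1, t - 2, t - 3.

module Submission where

open import Data.Empty using (⊥; ⊥-elim)
open import Data.List using (_∷_; [])
open import Data.Nat
open import Data.Nat.Coprimality using (Coprime; coprime-divisor; gcd≡1⇒coprime)
import Data.Nat.Coprimality as Coprimality
open import Data.Nat.DivMod
open import Data.Nat.Divisibility using (_∣_; divides; ∣⇒≤; ∣-refl; m%n≡0⇒n∣m)
open import Data.Nat.GCD using (gcd)
open import Data.Nat.Properties
open import Data.Nat.Tactic.RingSolver using (solve)
open import Data.Product using (∃-syntax; _×_; _,_; proj₁; proj₂)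
open import Data.Sum using (_⊎_; inj₁; inj₂; [_,_])
open import Function.Base using (_∘′_)
open import Function.Bundles using (_⇔_; mk⇔; Equivalence)
open import Relation.Binary.PropositionalEquality
  using (_≡_; _≢_; refl; sym; trans; cong; cong₂; subst; subst₂; module ≡-Reasoning)
open import Relation.Nullary using (¬_; Dec; yes; no; contradiction)
open import Algebra.Properties.CommutativeSemigroup +-commutativeSemigroup using (interchange)

open import Defs

Σ< : ℕ → (ℕ → ℕ) → ℕ
Σ< zero    f = 0
Σ< (suc j) f = Σ< j f + f j

Σ<-cong : ∀ j {f g} → (∀ i → i < j → f i ≡ g i) → Σ< j f ≡ Σ< j g
Σ<-cong zero    f≡g = refl
Σ<-cong (suc j) f≡g = cong₂ _+_ (Σ<-cong j (λ i i<j → f≡g i (m<n⇒m<1+n i<j))) (f≡g j ≤-refl)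

Σ<-+ : ∀ j f g → Σ< j (λ i → f i + g i) ≡ Σ< j f + Σ< j g
Σ<-+ zero    f g = refl
Σ<-+ (suc j) f g = trans (cong (_+ (f j + g j)) (Σ<-+ j f g)) (interchange (Σ< j f) (Σ< j g) (f j) (g j))

Σ<-mono-≤ : ∀ j {f g} → (∀ i → f i ≤ g i) → Σ< j f ≤ Σ< j g
Σ<-mono-≤ zero    f≤g = z≤n
Σ<-mono-≤ (suc j) f≤g = +-mono-≤ (Σ<-mono-≤ j f≤g) (f≤g j)

Σ<-zero : ∀ j {f} → (∀ i → i < j → f i ≡ 0) → Σ< j f ≡ 0
Σ<-zero zero    f≡0 = refl
Σ<-zero (suc j) f≡0 = cong₂ _+_ (Σ<-zero j (λ i i<j → f≡0 i (m<n⇒m<1+n i<j))) (f≡0 j ≤-refl)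

Σ<-single : ∀ j {f q} → q < j → (∀ i → i ≢ q → f i ≡ 0) → Σ< j f ≡ f q
Σ<-single (suc j) {f} {q} q<1+j f≡0 with m≤n⇒m<n∨m≡n (≤-pred q<1+j)
... | inj₁ q<j  = trans (cong₂ _+_ (Σ<-single j q<j f≡0) (f≡0 j (>⇒≢ q<j))) (+-identityʳ (f q))
... | inj₂ refl = cong (_+ f q) (Σ<-zero q (λ i i<q → f≡0 i (<⇒≢ i<q)))

Σ<-2^+1 : ∀ j → Σ< j (2 ^_) + 1 ≡ 2 ^ j
Σ<-2^+1 zero    = refl
Σ<-2^+1 (suc j) = begin
  Σ< j (2 ^_) + 2 ^ j + 1   ≡⟨ +-assoc (Σ< j (2 ^_)) (2 ^ j) 1 ⟩
  Σ< j (2 ^_) + (2 ^ j + 1) ≡⟨ cong (Σ< j (2 ^_) +_) (+-comm (2 ^ j) 1) ⟩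
  Σ< j (2 ^_) + (1 + 2 ^ j) ≡⟨ +-assoc (Σ< j (2 ^_)) 1 (2 ^ j) ⟨
  Σ< j (2 ^_) + 1 + 2 ^ j   ≡⟨ cong (_+ 2 ^ j) (Σ<-2^+1 j) ⟩
  2 ^ j + 2 ^ j             ≡⟨ cong (2 ^ j +_) (sym (+-identityʳ (2 ^ j))) ⟩
  2 ^ suc j                 ∎
  where open ≡-Reasoning

Σ<-2^ : ∀ j → Σ< j (2 ^_) ≡ 2 ^ j ∸ 1
Σ<-2^ j = trans (sym (m+n∸n≡m (Σ< j (2 ^_)) 1)) (cong (_∸ 1) (Σ<-2^+1 j))

Σ<-1 : ∀ j → Σ< j (λ _ → 1) ≡ j
Σ<-1 zero    = refl
Σ<-1 (suc j) = trans (cong (_+ 1) (Σ<-1 j)) (+-comm j 1)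

ind : {A : Set} → Dec A → ℕ
ind (yes _) = 1
ind (no _)  = 0

ind-yes : {A : Set} → A → (A? : Dec A) → ind A? ≡ 1
ind-yes a (yes _) = refl
ind-yes a (no ¬a) = contradiction a ¬a

ind-no : {A : Set} → ¬ A → (A? : Dec A) → ind A? ≡ 0
ind-no ¬a (yes a) = contradiction a ¬a
ind-no ¬a (no _)  = refl

δ : ℕ → ℕ → ℕ
δ q p = ind (p ≟ q)

δ-on : ∀ q → δ q q ≡ 1
δ-on q = ind-yes refl (q ≟ q)

δ-off : ∀ {q i} → i ≢ q → δ q i ≡ 0
δ-off {q} {i} i≢q = ind-no i≢q (i ≟ q)

Σ<-gap : ∀ j {f g p} → (∀ i → f i ≤ g i) → p < j → f p ≡ 0 → Σ< j f + g p ≤ Σ< j g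
Σ<-gap j {f} {g} {p} f≤g p<j fp≡0 = begin
  Σ< j f + g p                         ≡⟨ cong (Σ< j f +_) g-on ⟨
  Σ< j f + Σ< j (λ i → δ p i * g i)    ≡⟨ Σ<-+ j f (λ i → δ p i * g i) ⟨
  Σ< j (λ i → f i + δ p i * g i)       ≤⟨ Σ<-mono-≤ j pointwise ⟩
  Σ< j g                               ∎
  where
  open ≤-Reasoning
  g-on : Σ< j (λ i → δ p i * g i) ≡ g p
  g-on = begin-equality
    Σ< j (λ i → δ p i * g i) ≡⟨ Σ<-single j p<j (λ i i≢p → cong (_* g i) (δ-off i≢p)) ⟩
    δ p p * g p              ≡⟨ cong (_* g p) (δ-on p) ⟩
    1 * g p                  ≡⟨ *-identityˡ (g p) ⟩
    g p                      ∎
  pointwise : ∀ i → f i + δ p i * g i ≤ g i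
  pointwise i with i ≟ p
  ... | yes refl = ≤-reflexive (trans (cong (_+ (1 * g p)) fp≡0) (*-identityˡ (g p)))
  ... | no _     = ≤-trans (≤-reflexive (+-identityʳ (f i))) (f≤g i)

Bits : (ℕ → ℕ) → Set
Bits d = ∀ i → d i ≤ 1

val : ℕ → (ℕ → ℕ) → ℕ
val j d = Σ< j (λ i → d i * 2 ^ i)

weight : ℕ → (ℕ → ℕ) → ℕ
weight = Σ<

val-+ : ∀ j d d' → val j (λ i → d i + d' i) ≡ val j d + val j d'
val-+ j d d' = trans (Σ<-cong j (λ i _ → *-distribʳ-+ (2 ^ i) (d i) (d' i))) (Σ<-+ j _ _)

val-δ : ∀ {j q} → q < j → val j (δ q) ≡ 2 ^ q
val-δ {j} {q} q<j = begin
  val j (δ q)  ≡⟨ Σ<-single j q<j (λ i i≢q → cong (_* 2 ^ i) (δ-off i≢q)) ⟩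
  δ q q * 2 ^ q ≡⟨ cong (_* 2 ^ q) (δ-on q) ⟩
  1 * 2 ^ q     ≡⟨ *-identityˡ (2 ^ q) ⟩
  2 ^ q         ∎
  where open ≡-Reasoning

weight-δ : ∀ {j q} → q < j → weight j (δ q) ≡ 1
weight-δ {j} {q} q<j = trans (Σ<-single j q<j (λ i → δ-off)) (δ-on q)

bit-weighted-≤ : ∀ {d} → Bits d → ∀ i → d i * 2 ^ i ≤ 2 ^ i
bit-weighted-≤ {d} bits i = ≤-trans (*-monoˡ-≤ (2 ^ i) (bits i)) (≤-reflexive (*-identityˡ (2 ^ i)))

val<2^ : ∀ j {d} → Bits d → val j d < 2 ^ j
val<2^ j {d} bits = begin-strict
  val j d            ≤⟨ Σ<-mono-≤ j (bit-weighted-≤ bits) ⟩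
  Σ< j (2 ^_)        <⟨ m<m+n (Σ< j (2 ^_)) z<s ⟩
  Σ< j (2 ^_) + 1    ≡⟨ Σ<-2^+1 j ⟩
  2 ^ j              ∎
  where open ≤-Reasoning

val<2^∸1 : ∀ j {d p} → Bits d → p < j → d p ≡ 0 → val j d < 2 ^ j ∸ 1
val<2^∸1 j {d} {p} bits p<j dp≡0 = begin-strict
  val j d               <⟨ m<m+n (val j d) (m^n>0 2 p) ⟩
  val j d + 2 ^ p       ≤⟨ Σ<-gap j (bit-weighted-≤ bits) p<j (cong (_* 2 ^ p) dp≡0) ⟩
  Σ< j (2 ^_)           ≡⟨ Σ<-2^ j ⟩
  2 ^ j ∸ 1             ∎
  where open ≤-Reasoning

weight-full⇒all-set : ∀ j {d} → Bits d → weight j d ≡ j → ∀ i → i < j → d i ≡ 1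
weight-full⇒all-set j {d} bits full i i<j with n≤1⇒n≡0∨n≡1 (bits i)
... | inj₂ di≡1 = di≡1
... | inj₁ di≡0 = ⊥-elim (m+1+n≰m j (subst₂ (λ w v → w + 1 ≤ v) full (Σ<-1 j) (Σ<-gap j bits i<j di≡0)))

val-all-set : ∀ j {d} → (∀ i → i < j → d i ≡ 1) → val j d ≡ 2 ^ j ∸ 1
val-all-set j set = trans (Σ<-cong j (λ i i<j → trans (cong (_* 2 ^ i) (set i i<j)) (*-identityˡ (2 ^ i)))) (Σ<-2^ j)

weight<⇒unset : ∀ j {d} → Bits d → weight j d < j → ∃[ p ] p < j × d p ≡ 0
weight<⇒unset (suc j) {d} bits w<1+j with n≤1⇒n≡0∨n≡1 (bits j)
... | inj₁ dj≡0 = j , ≤-refl , dj≡0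
... | inj₂ dj≡1 with weight<⇒unset j bits (≤-pred (subst (_< suc j) w≡1+w w<1+j))
  where
  w≡1+w : weight (suc j) d ≡ suc (weight j d)
  w≡1+w = trans (cong (weight j d +_) dj≡1) (+-comm (weight j d) 1)
...   | p , p<j , dp≡0 = p , m<n⇒m<1+n p<j , dp≡0

val-suc-mono : ∀ j {d d'} → Bits d → d j ≡ 0 → d' j ≡ 1 → val (suc j) d < val (suc j) d'
val-suc-mono j {d} {d'} bits dj≡0 d'j≡1 = begin-strict
  val j d + d j * 2 ^ j    ≡⟨ cong (λ b → val j d + b * 2 ^ j) dj≡0 ⟩
  val j d + 0              ≡⟨ +-identityʳ (val j d) ⟩
  val j d                  <⟨ val<2^ j bits ⟩
  2 ^ j                    ≡⟨ *-identityˡ (2 ^ j) ⟨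
  1 * 2 ^ j                ≡⟨ cong (_* 2 ^ j) d'j≡1 ⟨
  d' j * 2 ^ j             ≤⟨ m≤n+m (d' j * 2 ^ j) (val j d') ⟩
  val j d' + d' j * 2 ^ j  ∎
  where open ≤-Reasoning

val-top-bit : ∀ j {d d'} → Bits d → Bits d' → val (suc j) d ≡ val (suc j) d' → d j ≡ d' j
val-top-bit j {d} {d'} bits bits' eq with n≤1⇒n≡0∨n≡1 (bits j) | n≤1⇒n≡0∨n≡1 (bits' j)
... | inj₁ dj≡0 | inj₁ d'j≡0 = trans dj≡0 (sym d'j≡0)
... | inj₂ dj≡1 | inj₂ d'j≡1 = trans dj≡1 (sym d'j≡1)
... | inj₁ dj≡0 | inj₂ d'j≡1 = contradiction eq (<⇒≢ (val-suc-mono j {d} {d'} bits dj≡0 d'j≡1))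
... | inj₂ dj≡1 | inj₁ d'j≡0 = contradiction eq (>⇒≢ (val-suc-mono j {d'} {d} bits' d'j≡0 dj≡1))

val-injective : ∀ j {d d'} → Bits d → Bits d' → val j d ≡ val j d' → ∀ i → i < j → d i ≡ d' i
val-injective (suc j) {d} {d'} bits bits' eq i i<1+j with m≤n⇒m<n∨m≡n (≤-pred i<1+j)
... | inj₂ refl = val-top-bit j bits bits' eq
... | inj₁ i<j  = val-injective j bits bits' lower i i<j
  where
  lower : val j d ≡ val j d'
  lower = +-cancelʳ-≡ (d j * 2 ^ j) (val j d) (val j d')
            (trans eq (cong (λ b → val j d' + b * 2 ^ j) (sym (val-top-bit j bits bits' eq))))

IsIndicator : (ℕ → ℕ) → (ℕ → Set) → Set
IsIndicator d A = ∀ p → (d p ≡ 1 × A p) ⊎ (d p ≡ 0 × ¬ A p)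

isIndicator⇒bits : ∀ {d A} → IsIndicator d A → Bits d
isIndicator⇒bits d≈A p with d≈A p
... | inj₁ (dp≡1 , _) = ≤-reflexive dp≡1
... | inj₂ (dp≡0 , _) = ≤-trans (≤-reflexive dp≡0) z≤n

isIndicator-∉ : ∀ {d A p} → IsIndicator d A → ¬ A p → d p ≡ 0
isIndicator-∉ {p = p} d≈A ¬a with d≈A p
... | inj₁ (_ , a)     = contradiction a ¬a
... | inj₂ (dp≡0 , _) = dp≡0

isIndicator-agree : ∀ {d d' A B p} → IsIndicator d A → IsIndicator d' B → d p ≡ d' p → A p ⇔ B p
isIndicator-agree {p = p} d≈A d'≈B dp≡d'p with d≈A p | d'≈B p
... | inj₁ (_ , a) | inj₁ (_ , b)  = mk⇔ (λ _ → b) (λ _ → a)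
... | inj₂ (_ , ¬a) | inj₂ (_ , ¬b) = mk⇔ (⊥-elim ∘′ ¬a) (⊥-elim ∘′ ¬b)
... | inj₁ (dp≡1 , _) | inj₂ (d'p≡0 , _) = contradiction (trans (sym dp≡1) (trans dp≡d'p d'p≡0)) (λ ())
... | inj₂ (dp≡0 , _) | inj₁ (d'p≡1 , _) = contradiction (trans (sym dp≡0) (trans dp≡d'p d'p≡1)) (λ ())

[m+n]%o≡m%o⇒o∣n : ∀ m n o .{{_ : NonZero o}} → (m + n) % o ≡ m % o → o ∣ n
[m+n]%o≡m%o⇒o∣n m n o eq = divides ((m + n) / o ∸ m / o) (sym (begin
  ((m + n) / o ∸ m / o) * o     ≡⟨ *-distribʳ-∸ o ((m + n) / o) (m / o) ⟩
  (m + n) / o * o ∸ m / o * o   ≡⟨ cong (_∸ m / o * o) quotients ⟨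
  m / o * o + n ∸ m / o * o     ≡⟨ m+n∸m≡n (m / o * o) n ⟩
  n                             ∎))
  where
  open ≡-Reasoning
  quotients : m / o * o + n ≡ (m + n) / o * o
  quotients = +-cancelˡ-≡ (m % o) _ _ (begin
    m % o + (m / o * o + n)     ≡⟨ +-assoc (m % o) (m / o * o) n ⟨
    m % o + m / o * o + n       ≡⟨ cong (_+ n) (m≡m%n+[m/n]*n m o) ⟨
    m + n                       ≡⟨ m≡m%n+[m/n]*n (m + n) o ⟩
    (m + n) % o + (m + n) / o * o ≡⟨ cong (_+ (m + n) / o * o) eq ⟩
    m % o + (m + n) / o * o     ∎)

[m%o+n]%o≡[m+n]%o : ∀ m n o .{{_ : NonZero o}} → (m % o + n) % o ≡ (m + n) % o
[m%o+n]%o≡[m+n]%o m n o = begin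
  (m % o + n) % o                 ≡⟨ [m+kn]%n≡m%n (m % o + n) (m / o) o ⟨
  (m % o + n + m / o * o) % o     ≡⟨ cong (_% o) (+-comm (m % o + n) (m / o * o)) ⟩
  (m / o * o + (m % o + n)) % o   ≡⟨ cong (_% o) (+-assoc (m / o * o) (m % o) n) ⟨
  (m / o * o + m % o + n) % o     ≡⟨ cong (λ x → (x + n) % o) (trans (m≡m%n+[m/n]*n m o) (+-comm (m % o) (m / o * o))) ⟨
  (m + n) % o                     ∎
  where open ≡-Reasoning

module Congruence (m : ℕ) .{{_ : NonZero m}} where

  infix 4 _≈_
  _≈_ : ℕ → ℕ → Set
  x ≈ y = x % m ≡ y % m

  ≈-+ : ∀ {x x' y y'} → x ≈ x' → y ≈ y' → x + y ≈ x' + y'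
  ≈-+ {x} {x'} {y} {y'} x≈x' y≈y' =
    trans (%-distribˡ-+ x y m) (trans (cong₂ (λ u v → (u + v) % m) x≈x' y≈y') (sym (%-distribˡ-+ x' y' m)))

  ≈-* : ∀ {x x' y y'} → x ≈ x' → y ≈ y' → x * y ≈ x' * y'
  ≈-* {x} {x'} {y} {y'} x≈x' y≈y' =
    trans (%-distribˡ-* x y m) (trans (cong₂ (λ u v → (u * v) % m) x≈x' y≈y') (sym (%-distribˡ-* x' y' m)))

  ≈-^ : ∀ {x y} q → x ≈ y → x ^ q ≈ y ^ q
  ≈-^ zero    x≈y = refl
  ≈-^ (suc q) x≈y = ≈-* x≈y (≈-^ q x≈y)

Exit : (ℕ → Set) → ℕ → ℕ → ℕ → Set
Exit A n d x = A x × x + d < n × ¬ A (x + d)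

UniqueExit : (ℕ → Set) → ℕ → ℕ → Set
UniqueExit A n d = ∀ {x y} → Exit A n d x → Exit A n d y → x ≡ y

uniqueExit-transfer : ∀ {A B n d} → (∀ {p} → p < n → A p ⇔ B p) → UniqueExit A n d → UniqueExit B n d
uniqueExit-transfer {A} {B} {n} {d} A⇔B unique ex ey = unique (toA ex) (toA ey)
  where
  toA : ∀ {x} → Exit B n d x → Exit A n d x
  toA {x} (bx , x+d<n , ¬b) =
    Equivalence.from (A⇔B (≤-<-trans (m≤m+n x d) x+d<n)) bx , x+d<n , ¬b ∘′ Equivalence.to (A⇔B x+d<n)

module Progression (n : ℕ) .{{_ : NonZero n}} (a k : ℕ) where

  term : ℕ → ℕ
  term i = (a + i * k) % n

  InProgression : ℕ → ℕ → Set
  InProgression L p = ∃[ i ] i < L × term i ≡ p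

  term-suc : ∀ i → term (suc i) ≡ (term i + k % n) % n
  term-suc i = begin
    (a + (k + i * k)) % n   ≡⟨ cong (λ x → (a + x) % n) (+-comm k (i * k)) ⟩
    (a + (i * k + k)) % n   ≡⟨ cong (_% n) (+-assoc a (i * k) k) ⟨
    (a + i * k + k) % n     ≡⟨ %-distribˡ-+ (a + i * k) k n ⟩
    (term i + k % n) % n    ∎
    where open ≡-Reasoning

  term<n : ∀ i → term i < n
  term<n i = m%n<n (a + i * k) n

  term-pred : ∀ i → (term (suc i) + (n ∸ k % n)) % n ≡ term i
  term-pred i = begin
    (term (suc i) + (n ∸ k % n)) % n          ≡⟨ cong (λ x → (x + (n ∸ k % n)) % n) (term-suc i) ⟩
    ((term i + k % n) % n + (n ∸ k % n)) % n  ≡⟨ [m%o+n]%o≡[m+n]%o (term i + k % n) (n ∸ k % n) n ⟩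
    (term i + k % n + (n ∸ k % n)) % n        ≡⟨ cong (_% n) (+-assoc (term i) (k % n) (n ∸ k % n)) ⟩
    (term i + (k % n + (n ∸ k % n))) % n      ≡⟨ cong (λ x → (term i + x) % n) (m+[n∸m]≡n (m%n≤n k n)) ⟩
    (term i + n) % n                          ≡⟨ [m+n]%n≡m%n (term i) n ⟩
    term i % n                                ≡⟨ m%n%n≡m%n (a + i * k) n ⟩
    term i                                    ∎
    where open ≡-Reasoning

  term-next : ∀ i {x} → term i ≡ x → x + k % n < n → term (suc i) ≡ x + k % n
  term-next i refl x+c<n = trans (term-suc i) (m<n⇒m%n≡m x+c<n)

  term-previous : ∀ i {x} → term (suc i) ≡ x → x + (n ∸ k % n) < n → term i ≡ x + (n ∸ k % n)
  term-previous i refl x+c′<n = trans (sym (term-pred i)) (m<n⇒m%n≡m x+c′<n)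

  forward-exit : ∀ {L x} → Exit (InProgression L) n (k % n) x → term (pred L) ≡ x
  forward-exit {L} ((i , i<L , termᵢ≡x) , x+c<n , ¬next) with suc i <? L
  ... | yes 1+i<L = contradiction (suc i , 1+i<L , term-next i termᵢ≡x x+c<n) ¬next
  ... | no 1+i≮L  = trans (cong (term ∘′ pred) (sym (≤-antisym i<L (≮⇒≥ 1+i≮L)))) termᵢ≡x

  backward-exit : ∀ {L x} → Exit (InProgression L) n (n ∸ k % n) x → term 0 ≡ x
  backward-exit ((zero , _ , term₀≡x) , _) = term₀≡x
  backward-exit ((suc i , 1+i<L , termᵢ₊₁≡x) , x+c′<n , ¬previous) =
    contradiction (i , <-trans (n<1+n i) 1+i<L , term-previous i termᵢ₊₁≡x x+c′<n) ¬previous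

  uniqueExit-forward : ∀ L → UniqueExit (InProgression L) n (k % n)
  uniqueExit-forward L ex ey = trans (sym (forward-exit ex)) (forward-exit ey)

  uniqueExit-backward : ∀ L → UniqueExit (InProgression L) n (n ∸ k % n)
  uniqueExit-backward L ex ey = trans (sym (backward-exit ex)) (backward-exit ey)

  term-injective : Coprime k n → ∀ {i j} → i < j → j < n → term i ≢ term j
  term-injective coprime {i} {j} i<j j<n termᵢ≡termⱼ = <-irrefl refl (begin-strict
    n        ≤⟨ ∣⇒≤ {{>-nonZero (m<n⇒0<n∸m i<j)}} n∣j∸i ⟩
    j ∸ i    ≤⟨ m∸n≤m j i ⟩
    j        <⟨ j<n ⟩
    n        ∎)
    where
    open ≤-Reasoning
    shift : a + j * k ≡ a + i * k + (j ∸ i) * k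
    shift = begin-equality
      a + j * k                   ≡⟨ cong (λ x → a + x * k) (m+[n∸m]≡n (<⇒≤ i<j)) ⟨
      a + (i + (j ∸ i)) * k       ≡⟨ cong (a +_) (*-distribʳ-+ k i (j ∸ i)) ⟩
      a + (i * k + (j ∸ i) * k)   ≡⟨ +-assoc a (i * k) ((j ∸ i) * k) ⟨
      a + i * k + (j ∸ i) * k     ∎
    n∣j∸i : n ∣ j ∸ i
    n∣j∸i = coprime-divisor (Coprimality.sym coprime)
      (subst (n ∣_) (*-comm (j ∸ i) k) ([m+n]%o≡m%o⇒o∣n (a + i * k) ((j ∸ i) * k) n (trans (cong (_% n) (sym shift)) (sym termᵢ≡termⱼ))))

  InProgression-suc : ∀ {L p} → InProgression (suc L) p → InProgression L p ⊎ term L ≡ p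
  InProgression-suc (i , i<1+L , termᵢ≡p) with m≤n⇒m<n∨m≡n (≤-pred i<1+L)
  ... | inj₁ i<L  = inj₁ (i , i<L , termᵢ≡p)
  ... | inj₂ refl = inj₂ termᵢ≡p

  word : ℕ → ℕ → ℕ
  word zero    p = 0
  word (suc L) p = word L p + δ (term L) p

  weight-word : ∀ L → weight n (word L) ≡ L
  weight-word zero    = Σ<-zero n (λ _ _ → refl)
  weight-word (suc L) = begin
    weight n (word (suc L))                  ≡⟨ Σ<-+ n (word L) (δ (term L)) ⟩
    weight n (word L) + weight n (δ (term L)) ≡⟨ cong₂ _+_ (weight-word L) (weight-δ (term<n L)) ⟩
    L + 1                                    ≡⟨ +-comm L 1 ⟩
    suc L                                    ∎
    where open ≡-Reasoning

  word-isIndicator : Coprime k n → ∀ {L} → L ≤ n → IsIndicator (word L) (InProgression L)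
  word-isIndicator coprime {zero}  _     p = inj₂ (refl , λ { (_ , () , _) })
  word-isIndicator coprime {suc L} 1+L≤n p with p ≟ term L | word-isIndicator coprime (<⇒≤ 1+L≤n) p
  ... | yes refl | inj₁ (_ , i , i<L , termᵢ≡p) = contradiction termᵢ≡p (term-injective coprime i<L 1+L≤n)
  ... | yes refl | inj₂ (wp≡0 , _)              = inj₁ (cong (_+ 1) wp≡0 , L , ≤-refl , refl)
  ... | no p≢    | inj₁ (wp≡1 , i , i<L , termᵢ≡p) =
    inj₁ (trans (+-identityʳ (word L p)) wp≡1 , i , m<n⇒m<1+n i<L , termᵢ≡p)
  ... | no p≢    | inj₂ (wp≡0 , p∉)             = inj₂ (trans (+-identityʳ (word L p)) wp≡0 , p∉′)
    where
    p∉′ : ¬ InProgression (suc L) p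
    p∉′ p∈ with InProgression-suc p∈
    ... | inj₁ p∈′      = p∉ p∈′
    ... | inj₂ termL≡p = p≢ (sym termL≡p)

Niho : ℕ → ℕ → ℕ → Set
Niho t s p = p < t ⊎ p ≡ s

ones : ℕ → ℕ → ℕ
ones t p = ind (p <? t)

nihoWord : ℕ → ℕ → ℕ → ℕ
nihoWord t s p = ones t p + δ s p

nihoWord-isIndicator : ∀ {t s} → t ≤ s → IsIndicator (nihoWord t s) (Niho t s)
nihoWord-isIndicator {t} {s} t≤s p with p <? t | p ≟ s
... | yes p<t | yes refl = contradiction t≤s (<⇒≱ p<t)
... | yes p<t | no _     = inj₁ (refl , inj₁ p<t)
... | no _    | yes refl = inj₁ (refl , inj₂ refl)
... | no p≮t  | no p≢s   = inj₂ (refl , [ p≮t , p≢s ])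

val-ones : ∀ {t} j → t ≤ j → val j (ones t) ≡ 2 ^ t ∸ 1
val-ones {t} j t≤j with m≤n⇒m<n∨m≡n t≤j
val-ones {t} j       _ | inj₂ refl  = val-all-set t (λ i i<t → ind-yes i<t (i <? t))
val-ones {t} (suc j) _ | inj₁ t<1+j = begin
  val j (ones t) + ones t j * 2 ^ j ≡⟨ cong (λ b → val j (ones t) + b * 2 ^ j) (ind-no (λ j<t → <⇒≱ j<t (≤-pred t<1+j)) (j <? t)) ⟩
  val j (ones t) + 0                ≡⟨ +-identityʳ (val j (ones t)) ⟩
  val j (ones t)                    ≡⟨ val-ones j (≤-pred t<1+j) ⟩
  2 ^ t ∸ 1                         ∎
  where open ≡-Reasoning

val-nihoWord : ∀ {t s n} → t ≤ n → s < n → val n (nihoWord t s) ≡ 2 ^ t + 2 ^ s ∸ 1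
val-nihoWord {t} {s} {n} t≤n s<n = begin
  val n (nihoWord t s)           ≡⟨ val-+ n (ones t) (δ s) ⟩
  val n (ones t) + val n (δ s)   ≡⟨ cong₂ _+_ (val-ones n t≤n) (val-δ s<n) ⟩
  2 ^ t ∸ 1 + 2 ^ s              ≡⟨ +-∸-comm (2 ^ s) (m^n>0 2 t) ⟨
  2 ^ t + 2 ^ s ∸ 1              ∎
  where open ≡-Reasoning

twoExits⇒¬uniqueExit : ∀ {A n d x y} → x ≢ y → Exit A n d x → Exit A n d y → ¬ UniqueExit A n d
twoExits⇒¬uniqueExit x≢y ex ey unique = x≢y (unique ex ey)

niho-exit : ∀ {t s n d x} → t + t ≤ n → d ≤ t → x < t → t ≤ d + x → d + x ≢ s → Exit (Niho t s) n d x
niho-exit {t} {s} {n} {d} {x} t+t≤n d≤t x<t t≤d+x d+x≢s = inj₁ x<t , x+d<n , [ x+d≮t , x+d≢s ]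
  where
  x+d<n : x + d < n
  x+d<n = <-≤-trans (+-mono-<-≤ x<t d≤t) t+t≤n
  x+d≮t : ¬ x + d < t
  x+d≮t x+d<t = <⇒≱ x+d<t (subst (t ≤_) (+-comm d x) t≤d+x)
  x+d≢s : x + d ≢ s
  x+d≢s x+d≡s = d+x≢s (trans (+-comm d x) x+d≡s)

niho-¬uniqueExit-three : ∀ {t s n d x} → t + t ≤ n → d ≤ t → 2 + x < t → t ≤ d + x →
                         ¬ UniqueExit (Niho t s) n d
niho-¬uniqueExit-three {t} {s} {n} {d} {x} t+t≤n d≤t 2+x<t t≤d+x = choose (d + x₂ ≟ s) (d + x₁ ≟ s)
  where
  x₁ x₂ : ℕ
  x₁ = suc x
  x₂ = suc x₁
  x₂<t : x₂ < t
  x₂<t = 2+x<t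
  x₁<t : x₁ < t
  x₁<t = <-trans (n<1+n x₁) x₂<t
  x<t : x < t
  x<t = <-trans (n<1+n x) x₁<t
  exit : ∀ {y} → y < t → x ≤ y → d + y ≢ s → Exit (Niho t s) n d y
  exit y<t x≤y = niho-exit t+t≤n d≤t y<t (≤-trans t≤d+x (+-monoʳ-≤ d x≤y))
  missed : ∀ {y z} → y < z → d + z ≡ s → d + y ≢ s
  missed y<z d+z≡s d+y≡s = <⇒≢ (+-monoʳ-< d y<z) (trans d+y≡s (sym d+z≡s))
  choose : Dec (d + x₂ ≡ s) → Dec (d + x₁ ≡ s) → ¬ UniqueExit (Niho t s) n d
  choose (yes hit₂) _ = twoExits⇒¬uniqueExit (<⇒≢ (n<1+n x))
    (exit x<t ≤-refl (missed (<-trans (n<1+n x) (n<1+n x₁)) hit₂)) (exit x₁<t (n≤1+n x) (missed (n<1+n x₁) hit₂))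
  choose (no miss₂) (yes hit₁) = twoExits⇒¬uniqueExit (<⇒≢ (<-trans (n<1+n x) (n<1+n x₁)))
    (exit x<t ≤-refl (missed (n<1+n x) hit₁)) (exit x₂<t (<⇒≤ (<-trans (n<1+n x) (n<1+n x₁))) miss₂)
  choose (no miss₂) (no miss₁) = twoExits⇒¬uniqueExit (<⇒≢ (n<1+n x₁))
    (exit x₁<t (n≤1+n x) miss₁) (exit x₂<t (<⇒≤ (<-trans (n<1+n x) (n<1+n x₁))) miss₂)

niho-¬uniqueExit : ∀ {t s n d} → 3 ≤ t → 2 + t ≤ s → suc s < n → t + t ≤ n →
                   1 ≤ d → d ≤ t → ¬ UniqueExit (Niho t s) n d
niho-¬uniqueExit {t} {s} {n} {1} (s≤s (s≤s (s≤s _))) 2+t≤s 1+s<n t+t≤n _ d≤t =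
  twoExits⇒¬uniqueExit (<⇒≢ (<-trans ≤-refl t<s))
    (niho-exit t+t≤n d≤t ≤-refl ≤-refl (<⇒≢ t<s))
    (inj₂ refl , subst (_< n) (+-comm 1 s) 1+s<n , [ s+1≮t , m+1+n≢m s ])
  where
  t<s : t < s
  t<s = ≤-trans (n≤1+n (suc t)) 2+t≤s
  s+1≮t : ¬ s + 1 < t
  s+1≮t s+1<t = <⇒≱ s+1<t (≤-trans (<⇒≤ t<s) (m≤m+n s 1))
niho-¬uniqueExit {t} {s} {n} {2} (s≤s (s≤s (s≤s {n = u} _))) 2+t≤s _ t+t≤n _ d≤t =
  twoExits⇒¬uniqueExit (1+n≢n {suc u})
    (niho-exit t+t≤n d≤t ≤-refl (n≤1+n t) (<⇒≢ 2+t≤s))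
    (niho-exit t+t≤n d≤t (n≤1+n (suc (suc u))) ≤-refl (<⇒≢ (≤-trans (n≤1+n (suc t)) 2+t≤s)))
niho-¬uniqueExit {d = suc (suc (suc d′))} (s≤s (s≤s (s≤s {n = u} _))) _ _ t+t≤n _ d≤t =
  niho-¬uniqueExit-three {x = u} t+t≤n d≤t ≤-refl (s≤s (s≤s (s≤s (m≤n+m u d′))))

niho-not-progression : ∀ {n t s a k L} .{{_ : NonZero n}} → n ≡ suc (t + t) → 3 ≤ t → 2 + t ≤ s → suc s < n →
                       Coprime k n → ¬ (∀ {p} → p < n → Progression.InProgression n a k L p ⇔ Niho t s p)
niho-not-progression {n} {t} {s} {a} {k} {L} refl 3≤t 2+t≤s 1+s<n coprime agree = split (k % n ≤? t)
  where
  module P = Progression n a k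
  t+t≤n : t + t ≤ n
  t+t≤n = n≤1+n (t + t)
  1<n : 1 < n
  1<n = s≤s (≤-trans (≤-trans (s≤s z≤n) 3≤t) (m≤m+n t t))
  step≢0 : k % n ≢ 0
  step≢0 k%n≡0 = <⇒≢ 1<n (sym (coprime (m%n≡0⇒n∣m k n k%n≡0 , ∣-refl)))
  split : Dec (k % n ≤ t) → ⊥
  split (yes step≤t) = niho-¬uniqueExit 3≤t 2+t≤s 1+s<n t+t≤n (n≢0⇒n>0 step≢0) step≤t
                         (uniqueExit-transfer agree (P.uniqueExit-forward L))
  split (no step≰t)  = niho-¬uniqueExit 3≤t 2+t≤s 1+s<n t+t≤n (m<n⇒0<n∸m (m%n<n k n)) back≤t
                         (uniqueExit-transfer agree (P.uniqueExit-backward L))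
    where
    back≤t : n ∸ k % n ≤ t
    back≤t = ≤-trans (∸-monoʳ-≤ n (≰⇒> step≰t)) (≤-reflexive (m+n∸m≡n t t))

e-+ : ∀ x y k → e (x + y) k ≡ e x k + 2 ^ (x * k) * e y k
e-+ x zero    k = begin
  e (x + 0) k                 ≡⟨ cong (λ z → e z k) (+-identityʳ x) ⟩
  e x k                       ≡⟨ +-identityʳ (e x k) ⟨
  e x k + 0                   ≡⟨ cong (e x k +_) (*-zeroʳ (2 ^ (x * k))) ⟨
  e x k + 2 ^ (x * k) * 0     ∎
  where open ≡-Reasoning
e-+ x (suc y) k = begin
  e (x + suc y) k                                           ≡⟨ cong (λ z → e z k) (+-suc x y) ⟩
  e (x + y) k + 2 ^ ((x + y) * k)                           ≡⟨ cong₂ _+_ (e-+ x y k) (trans (cong (2 ^_) (*-distribʳ-+ k x y)) (^-distribˡ-+-* 2 (x * k) (y * k))) ⟩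
  e x k + 2 ^ (x * k) * e y k + 2 ^ (x * k) * 2 ^ (y * k)   ≡⟨ +-assoc (e x k) _ _ ⟩
  e x k + (2 ^ (x * k) * e y k + 2 ^ (x * k) * 2 ^ (y * k)) ≡⟨ cong (e x k +_) (*-distribˡ-+ (2 ^ (x * k)) (e y k) (2 ^ (y * k))) ⟨
  e x k + 2 ^ (x * k) * e (suc y) k                         ∎
  where open ≡-Reasoning

module Mersenne (n : ℕ) .{{_ : NonZero n}} where

  M : ℕ
  M = 2 ^ n ∸ 1

  1<2^n : 1 < 2 ^ n
  1<2^n = ^-monoʳ-≤ 2 (>-nonZero⁻¹ n)

  instance
    M-nonZero : NonZero M
    M-nonZero = >-nonZero (m<n⇒0<n∸m 1<2^n)

  open Congruence M
  module P = Progression n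

  2^n≈1 : 2 ^ n ≈ 1
  2^n≈1 = trans (cong (_% M) (sym (m+[n∸m]≡n (<⇒≤ 1<2^n)))) ([m+n]%n≡m%n 1 M)

  2^≈2^[%n] : ∀ x → 2 ^ x ≈ 2 ^ (x % n)
  2^≈2^[%n] x = begin
    2 ^ x % M                            ≡⟨ cong (λ y → 2 ^ y % M) (m≡m%n+[m/n]*n x n) ⟩
    2 ^ (x % n + x / n * n) % M          ≡⟨ cong (_% M) (^-distribˡ-+-* 2 (x % n) (x / n * n)) ⟩
    (2 ^ (x % n) * 2 ^ (x / n * n)) % M  ≡⟨ ≈-* {2 ^ (x % n)} refl full-periods ⟩
    (2 ^ (x % n) * 1) % M                ≡⟨ cong (_% M) (*-identityʳ (2 ^ (x % n))) ⟩
    2 ^ (x % n) % M                      ∎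
    where
    open ≡-Reasoning
    full-periods : 2 ^ (x / n * n) ≈ 1
    full-periods = begin
      2 ^ (x / n * n) % M     ≡⟨ cong (λ y → 2 ^ y % M) (*-comm (x / n) n) ⟩
      2 ^ (n * (x / n)) % M   ≡⟨ cong (_% M) (^-*-assoc 2 n (x / n)) ⟨
      (2 ^ n) ^ (x / n) % M   ≡⟨ ≈-^ (x / n) 2^n≈1 ⟩
      1 ^ (x / n) % M         ≡⟨ cong (_% M) (^-zeroˡ (x / n)) ⟩
      1 % M                   ∎

  val-word : ∀ a k L → val n (P.word a k L) ≈ 2 ^ a * e L k
  val-word a k zero    = cong (_% M) (sym (trans (*-zeroʳ (2 ^ a)) (sym (Σ<-zero n (λ _ _ → refl)))))
  val-word a k (suc L) = begin
    val n (P.word a k (suc L)) % M                     ≡⟨ cong (_% M) (val-+ n (P.word a k L) (δ (P.term a k L))) ⟩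
    (val n (P.word a k L) + val n (δ (P.term a k L))) % M ≡⟨ cong (λ x → (val n (P.word a k L) + x) % M) (val-δ (P.term<n a k L)) ⟩
    (val n (P.word a k L) + 2 ^ P.term a k L) % M      ≡⟨ ≈-+ (val-word a k L) (sym (2^≈2^[%n] (a + L * k))) ⟩
    (2 ^ a * e L k + 2 ^ (a + L * k)) % M              ≡⟨ cong (λ x → (2 ^ a * e L k + x) % M) (^-distribˡ-+-* 2 a (L * k)) ⟩
    (2 ^ a * e L k + 2 ^ a * 2 ^ (L * k)) % M          ≡⟨ cong (_% M) (*-distribˡ-+ (2 ^ a) (e L k) (2 ^ (L * k))) ⟨
    2 ^ a * e (suc L) k % M                            ∎
    where open ≡-Reasoning

  module _ {k : ℕ} (coprime : Coprime k n) where

    -- 0, k, 2k, … reduced mod n run through all n residues, so the word of e(n,k) is all ones, i.e. M.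
    e≈0 : e n k ≈ 0
    e≈0 = begin
      e n k % M                 ≡⟨ cong (_% M) (*-identityˡ (e n k)) ⟨
      1 * e n k % M             ≡⟨ val-word 0 k n ⟨
      val n (P.word 0 k n) % M  ≡⟨ cong (_% M) (val-all-set n all-set) ⟩
      M % M                     ≡⟨ n%n≡0 M ⟩
      0                         ≡⟨ m<n⇒m%n≡m (>-nonZero⁻¹ M) ⟨
      0 % M                     ∎
      where
      open ≡-Reasoning
      all-set : ∀ i → i < n → P.word 0 k n i ≡ 1
      all-set = weight-full⇒all-set n (isIndicator⇒bits (P.word-isIndicator 0 k coprime ≤-refl)) (P.weight-word 0 k n)

    e-periodic : ∀ r q → e (r + q * n) k ≈ e r k
    e-periodic r zero    = cong (λ x → e x k % M) (+-identityʳ r)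
    e-periodic r (suc q) = begin
      e (r + (n + q * n)) k % M                          ≡⟨ cong (λ x → e x k % M) (trans (cong (r +_) (+-comm n (q * n))) (sym (+-assoc r (q * n) n))) ⟩
      e (r + q * n + n) k % M                            ≡⟨ cong (_% M) (e-+ (r + q * n) n k) ⟩
      (e (r + q * n) k + 2 ^ ((r + q * n) * k) * e n k) % M ≡⟨ ≈-+ (e-periodic r q) (≈-* {2 ^ ((r + q * n) * k)} refl e≈0) ⟩
      (e r k + 2 ^ ((r + q * n) * k) * 0) % M            ≡⟨ cong (λ x → (e r k + x) % M) (*-zeroʳ (2 ^ ((r + q * n) * k))) ⟩
      (e r k + 0) % M                                    ≡⟨ cong (_% M) (+-identityʳ (e r k)) ⟩
      e r k % M                                          ∎
      where open ≡-Reasoning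

    e≈e[%n] : ∀ l → e l k ≈ e (l % n) k
    e≈e[%n] l = trans (cong (λ x → e x k % M) (m≡m%n+[m/n]*n l n)) (e-periodic (l % n) (l / n))

    coset-digits : ∀ {a l d} → Bits d → val n d < M → 2 ^ a * e l k ≈ val n d →
                   ∀ p → p < n → P.word a k (l % n) p ≡ d p
    coset-digits {a} {l} {d} bits val<M coset = val-injective n word-bits bits values-equal
      where
      L : ℕ
      L = l % n
      word-bits : Bits (P.word a k L)
      word-bits = isIndicator⇒bits (P.word-isIndicator a k coprime (<⇒≤ (m%n<n l n)))
      word<M : val n (P.word a k L) < M
      word<M with weight<⇒unset n word-bits (subst (_< n) (sym (P.weight-word a k L)) (m%n<n l n))
      ... | p , p<n , unset = val<2^∸1 n word-bits p<n unset
      values-equal : val n (P.word a k L) ≡ val n d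
      values-equal = begin
        val n (P.word a k L)      ≡⟨ m<n⇒m%n≡m word<M ⟨
        val n (P.word a k L) % M  ≡⟨ val-word a k L ⟩
        2 ^ a * e L k % M         ≡⟨ ≈-* {2 ^ a} refl (e≈e[%n] l) ⟨
        2 ^ a * e l k % M         ≡⟨ coset ⟩
        val n d % M               ≡⟨ m<n⇒m%n≡m val<M ⟩
        val n d                   ∎
        where open ≡-Reasoning

    niho-coset-support : ∀ a l {t s} → t < s → s < n → 2 ^ a * e l k ≈ 2 ^ t + 2 ^ s ∸ 1 →
                         ∀ {p} → p < n → P.InProgression a k (l % n) p ⇔ Niho t s p
    niho-coset-support a l {t} {s} t<s s<n coset {p} p<n =
      isIndicator-agree (P.word-isIndicator a k coprime (<⇒≤ (m%n<n l n))) niho (digits p p<n)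
      where
      niho : IsIndicator (nihoWord t s) (Niho t s)
      niho = nihoWord-isIndicator (<⇒≤ t<s)
      t<n : t < n
      t<n = <-trans t<s s<n
      niho<M : val n (nihoWord t s) < M
      niho<M = val<2^∸1 n (isIndicator⇒bits niho) t<n (isIndicator-∉ niho [ <-irrefl refl , <⇒≢ t<s ])
      digits : ∀ p → p < n → P.word a k (l % n) p ≡ nihoWord t s p
      digits = coset-digits (isIndicator⇒bits niho) niho<M (trans coset (cong (_% M) (sym (val-nihoWord (<⇒≤ t<n) s<n))))

odd>1⇒≥3 : ∀ {t} → 1 < t → t % 2 ≡ 1 → 3 ≤ t
odd>1⇒≥3 {suc zero}          (s≤s ()) _
odd>1⇒≥3 {suc (suc zero)}    _ ()
odd>1⇒≥3 {suc (suc (suc _))} _ _ = s≤s (s≤s (s≤s z≤n))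

niho-exponent-bounds : ∀ {t} → 3 ≤ t → 2 + t ≤ (3 * t + 1) / 2 × (3 * t + 1) / 2 < t + t
niho-exponent-bounds {t} (s≤s (s≤s (s≤s {n = u} _))) = lower , upper
  where
  lower : 2 + t ≤ (3 * t + 1) / 2
  lower = subst (_≤ (3 * t + 1) / 2) (m*n/n≡m (2 + t) 2)
            (/-monoˡ-≤ 2 (subst ((2 + t) * 2 ≤_) slack (m≤m+n ((2 + t) * 2) u)))
    where
    slack : (2 + t) * 2 + u ≡ 3 * t + 1
    slack = solve (u ∷ [])
  upper : (3 * t + 1) / 2 < t + t
  upper = m<n*o⇒m/o<n {o = 2} (subst (suc (3 * t + 1) ≤_) slack (m≤m+n (suc (3 * t + 1)) (suc u)))
    where
    slack : suc (3 * t + 1) + suc u ≡ (t + t) * 2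
    slack = solve (u ∷ [])

theorem8 : (t : ℕ) → 1 < t → t % 2 ≡ 1 → (k : ℕ) → gcd k (2 * t + 1) ≡ 1 →
    .{{_ : NonZero (2 ^ (2 * t + 1) ∸ 1)}} →
    (l : ℕ) → ¬ InCyclotomicCoset (2 * t + 1) (nihoOdd t) (e l k)
theorem8 t 1<t t-odd k gcd≡1 l (a , coset) =
  niho-not-progression n≡1+t+t 3≤t 2+t≤s 1+s<n coprime
    (niho-coset-support coprime a l t<s (<-trans (n<1+n s) 1+s<n) coset)
  where
  n s : ℕ
  n = 2 * t + 1
  s = (3 * t + 1) / 2
  n≡1+t+t : 2 * t + 1 ≡ suc (t + t)
  n≡1+t+t = solve (t ∷ [])
  instance
    n-nonZero : NonZero n
    n-nonZero = subst NonZero (sym n≡1+t+t) _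
  open Mersenne n
  coprime : Coprime k n
  coprime = gcd≡1⇒coprime gcd≡1
  3≤t : 3 ≤ t
  3≤t = odd>1⇒≥3 1<t t-odd
  2+t≤s : 2 + t ≤ s
  2+t≤s = proj₁ (niho-exponent-bounds 3≤t)
  t<s : t < s
  t<s = ≤-trans (n≤1+n (suc t)) 2+t≤s
  1+s<n : suc s < n
  1+s<n = subst (suc (suc s) ≤_) (sym n≡1+t+t) (s≤s (proj₂ (niho-exponent-bounds 3≤t)))
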